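{- Let $G$ be a finite bipartite graph and $b:V(G)\to\mathbb{Z}_{\ge0}$. Then every edge of every $b$-flexible component of $G$ is $b$-flexible; that is, every edge whose two ends lie in the same $b$-flexible component is $b$-flexible.
   Context: A $b$-matching is $M\subseteq E(G)$ with at most $b(v)$ edges of $M$ at each vertex $v$; maximum = largest cardinality. An edge is $b$-allowed if it lies in some maximum $b$-matching; a $b$-allowed edge is $b$-inevitable if it lies in every maximum $b$-matching and $b$-flexible otherwise. A $b$-flexible component is an induced subgraph $G[V(K)]$ where $K$ is a connected component of the spanning subgraph $(V(G),\{b\text{ -flexible edges}\})$. -}

module Defs where

open import Data.Nat using (ℕ; zero; suc; _+_; _≤_)
open import Data.Fin using (Fin; zero; suc; _≟_)
open import Data.Bool using (Bool; true; false; _∨_; _∧_)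
open import Data.Product using (Σ; _×_; _,_; proj₁; proj₂; ∃)
open import Data.Sum using (_⊎_)
open import Relation.Nullary using (¬_; does)
open import Relation.Binary.PropositionalEquality using (_≡_; _≢_)
open import Relation.Binary.Construct.Closure.ReflexiveTransitive using (Star)

record Graph : Set where
  field
    n    : ℕ
    m    : ℕ
    ends : Fin m → Fin n × Fin n

open Graph public

sumFin : (k : ℕ) → (Fin k → ℕ) → ℕ
sumFin zero    f = 0
sumFin (suc k) f = f zero + sumFin k (λ i → f (suc i))

bit : Bool → ℕ
bit true  = 1
bit false = 0

EdgeSet : Graph → Set
EdgeSet G = Fin (m G) → Bool

size : (G : Graph) → EdgeSet G → ℕ
size G M = sumFin (m G) (λ e → bit (M e))

incident : (G : Graph) → Fin (n G) → Fin (m G) → Bool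
incident G v e = does (proj₁ (ends G e) ≟ v) ∨ does (proj₂ (ends G e) ≟ v)

degIn : (G : Graph) → EdgeSet G → Fin (n G) → ℕ
degIn G M v = sumFin (m G) (λ e → bit (M e ∧ incident G v e))

Simple : Graph → Set
Simple G =
  (∀ e → proj₁ (ends G e) ≢ proj₂ (ends G e)) ×
  (∀ e f → (proj₁ (ends G e) ≡ proj₁ (ends G f) × proj₂ (ends G e) ≡ proj₂ (ends G f))
         ⊎ (proj₁ (ends G e) ≡ proj₂ (ends G f) × proj₂ (ends G e) ≡ proj₁ (ends G f))
         → e ≡ f)

Bipartite : Graph → Set
Bipartite G = Σ (Fin (n G) → Bool) λ c →
  ∀ e → c (proj₁ (ends G e)) ≢ c (proj₂ (ends G e))

module _ (G : Graph) (b : Fin (n G) → ℕ) where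

  IsBMatching : EdgeSet G → Set
  IsBMatching M = ∀ v → degIn G M v ≤ b v

  IsMaxBMatching : EdgeSet G → Set
  IsMaxBMatching M = IsBMatching M × (∀ M' → IsBMatching M' → size G M' ≤ size G M)

  BAllowed : Fin (m G) → Set
  BAllowed e = Σ (EdgeSet G) λ M → IsMaxBMatching M × M e ≡ true

  BInevitable : Fin (m G) → Set
  BInevitable e = BAllowed e × (∀ M → IsMaxBMatching M → M e ≡ true)

  BFlexible : Fin (m G) → Set
  BFlexible e = BAllowed e × ¬ BInevitable e

  FlexAdj : Fin (n G) → Fin (n G) → Set
  FlexAdj u v = Σ (Fin (m G)) λ e → BFlexible e ×
    ((proj₁ (ends G e) ≡ u × proj₂ (ends G e) ≡ v) ⊎
     (proj₁ (ends G e) ≡ v × proj₂ (ends G e) ≡ u))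

  SameFlexComponent : Fin (n G) → Fin (n G) → Set
  SameFlexComponent = Star FlexAdj

-- Fix a proper 2-colouring (sides A and B) and a maximum b-matching M.  Its
-- residual digraph D(M) has an arc for every edge (from A to B if the edge is not in
-- M, from B to A if it is), plus a source joined to side A and a sink joined to side
-- B that account for vertices of degree below b.  The proof rests on two facts:
--
--   * Exchange lemma: if the arc of an edge e lies on a cycle of D(M), toggling the
--     edges along the cycle gives a maximum b-matching that disagrees with M on e.  It is proved by
--     double counting the ends of matching edges inside the set.
--
-- By the cut lemma applied to the set of nodes reachable from its head, the arc of a
-- b-flexible edge lies on a cycle, so its ends are strongly connected in D(M); hence
-- so are all vertices of a b-flexible component.  An edge e inside the component
-- therefore has its arc on a cycle, and the exchange lemma makes e b-flexible.  The
-- reachable set is only available classically, so this runs in the double-negation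
-- monad, which b-flexibility escapes because b-allowedness is decidable.
module Submission where

open import Defs
open import Level using (0ℓ)
open import Data.Nat using (ℕ; zero; suc; _+_; _*_; _≤_; _<_; z≤n; s≤s; _<?_)
open import Data.Nat.Properties hiding (_≟_)
open import Data.Fin using (Fin; zero; suc; _≟_)
open import Data.Fin.Properties using (all?) renaming (suc-injective to fin-suc-injective)
open import Data.Fin.Subset.Properties using (anySubset?)
open import Data.Vec using (lookup; tabulate)
open import Data.Vec.Properties using (lookup∘tabulate)
open import Data.Bool using (Bool; true; false; _∧_; not; if_then_else_) renaming (_≟_ to _≟ᴮ_)
open import Data.Bool.Properties using (∧-zeroʳ; ∨-zeroʳ; ¬-not; not-involutive)
open import Data.Product using (Σ; _×_; _,_; proj₁; proj₂)
open import Data.Sum using (_⊎_; inj₁; inj₂; swap)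
open import Data.Empty using (⊥-elim)
open import Data.Unit using (⊤; tt)
open import Data.List using (List; []; _∷_)
open import Data.List.Relation.Unary.Any using (here; there)
open import Data.List.Membership.Propositional using (_∈_; _∉_)
open import Relation.Nullary using (¬_; Dec; yes; no; does; _×-dec_)
open import Relation.Nullary.Decidable using (dec-true; dec-false; decidable-stable; ¬¬-excluded-middle)
open import Relation.Nullary.Negation using (¬¬-Monad)
open import Effect.Monad using (RawMonad)
open import Relation.Binary.PropositionalEquality
open import Relation.Binary.Definitions using (DecidableEquality)
open import Relation.Binary.Construct.Closure.ReflexiveTransitive using (Star; ε; _◅_; _◅◅_)
open import Algebra.Properties.Semiring.Sum +-*-semiring
  using (sum; ∑-distrib-+; ∑-comm; *-distribˡ-sum)

open RawMonad (¬¬-Monad {0ℓ}) using (_>>=_; pure)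

true-false : ∀ {A : Set} {β} → β ≡ true → β ≡ false → A
true-false refl ()

∧-absorb : ∀ β γ ι → (β ≡ true → ι ≡ true → γ ≡ true) → β ∧ ι ≡ β ∧ (γ ∧ ι)
∧-absorb false _ _     _     = refl
∧-absorb true  γ false _     = sym (∧-zeroʳ γ)
∧-absorb true  γ true  force = cong (_∧ true) (sym (force refl refl))

-- The summation `sumFin` of Defs is the library's `sum`, so its laws can be imported.
sumFin≡sum : ∀ k (f : Fin k → ℕ) → sumFin k f ≡ sum f
sumFin≡sum zero    f = refl
sumFin≡sum (suc k) f = cong (f zero +_) (sumFin≡sum k (λ i → f (suc i)))

sumFin-cong : ∀ k {f g : Fin k → ℕ} → (∀ i → f i ≡ g i) → sumFin k f ≡ sumFin k g
sumFin-cong zero    f≗g = refl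
sumFin-cong (suc k) f≗g = cong₂ _+_ (f≗g zero) (sumFin-cong k (λ i → f≗g (suc i)))

sumFin-mono : ∀ k {f g : Fin k → ℕ} → (∀ i → f i ≤ g i) → sumFin k f ≤ sumFin k g
sumFin-mono zero    f≤g = z≤n
sumFin-mono (suc k) f≤g = +-mono-≤ (f≤g zero) (sumFin-mono k (λ i → f≤g (suc i)))

sumFin-strict : ∀ k {f g : Fin k → ℕ} → (∀ i → f i ≤ g i) → (j : Fin k) → f j < g j →
  sumFin k f < sumFin k g
sumFin-strict (suc k) f≤g zero    lt = +-mono-<-≤ lt (sumFin-mono k (λ i → f≤g (suc i)))
sumFin-strict (suc k) f≤g (suc j) lt = +-mono-≤-< (f≤g zero) (sumFin-strict k (λ i → f≤g (suc i)) j lt)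

sumFin-+ : ∀ k (f g : Fin k → ℕ) → sumFin k (λ i → f i + g i) ≡ sumFin k f + sumFin k g
sumFin-+ k f g = begin
  sumFin k (λ i → f i + g i)  ≡⟨ sumFin≡sum k _ ⟩
  sum (λ i → f i + g i)       ≡⟨ ∑-distrib-+ f g ⟩
  sum f + sum g               ≡⟨ cong₂ _+_ (sumFin≡sum k f) (sumFin≡sum k g) ⟨
  sumFin k f + sumFin k g     ∎
  where open ≡-Reasoning

sumFin-*ˡ : ∀ k a (f : Fin k → ℕ) → sumFin k (λ i → a * f i) ≡ a * sumFin k f
sumFin-*ˡ k a f = begin
  sumFin k (λ i → a * f i)  ≡⟨ sumFin≡sum k _ ⟩
  sum (λ i → a * f i)       ≡⟨ *-distribˡ-sum a f ⟨
  a * sum f                 ≡⟨ cong (a *_) (sumFin≡sum k f) ⟨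
  a * sumFin k f            ∎
  where open ≡-Reasoning

sumFin-swap : ∀ k l (h : Fin k → Fin l → ℕ) →
  sumFin k (λ i → sumFin l (h i)) ≡ sumFin l (λ j → sumFin k (λ i → h i j))
sumFin-swap k l h = begin
  sumFin k (λ i → sumFin l (h i))          ≡⟨ sumFin-cong k (λ i → sumFin≡sum l (h i)) ⟩
  sumFin k (λ i → sum (h i))               ≡⟨ sumFin≡sum k _ ⟩
  sum (λ i → sum (h i))                    ≡⟨ ∑-comm h ⟩
  sum (λ j → sum (λ i → h i j))            ≡⟨ sumFin≡sum l _ ⟨
  sumFin l (λ j → sum (λ i → h i j))       ≡⟨ sumFin-cong l (λ j → sumFin≡sum k (λ i → h i j)) ⟨
  sumFin l (λ j → sumFin k (λ i → h i j))  ∎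
  where open ≡-Reasoning

sumFin-zero : ∀ k {f : Fin k → ℕ} → (∀ i → f i ≡ 0) → sumFin k f ≡ 0
sumFin-zero zero    f≗0 = refl
sumFin-zero (suc k) f≗0 = cong₂ _+_ (f≗0 zero) (sumFin-zero k (λ i → f≗0 (suc i)))

sumFin-indicator : ∀ k (f : Fin k → ℕ) (p : Fin k) → sumFin k (λ i → f i * bit (does (p ≟ i))) ≡ f p
sumFin-indicator (suc k) f zero = begin
  f zero * 1 + sumFin k (λ i → f (suc i) * 0)  ≡⟨ cong₂ _+_ (*-identityʳ (f zero)) (sumFin-zero k (λ i → *-zeroʳ (f (suc i)))) ⟩
  f zero + 0                                   ≡⟨ +-identityʳ _ ⟩
  f zero                                       ∎
  where open ≡-Reasoning
sumFin-indicator (suc k) f (suc p) = begin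
  f zero * 0 + sumFin k (λ i → f (suc i) * bit (does (suc p ≟ suc i)))
    ≡⟨ cong₂ _+_ (*-zeroʳ (f zero)) (sumFin-cong k (λ i → cong (λ z → f (suc i) * bit z) (suc-≟ i))) ⟩
  sumFin k (λ i → f (suc i) * bit (does (p ≟ i)))
    ≡⟨ sumFin-indicator k (λ i → f (suc i)) p ⟩
  f (suc p) ∎
  where
  open ≡-Reasoning
  suc-≟ : ∀ i → does (suc p ≟ suc i) ≡ does (p ≟ i)
  suc-≟ i with p ≟ i
  ... | yes refl = refl
  ... | no _     = refl

sumFin-differ-at : ∀ k (f g : Fin k → ℕ) (j : Fin k) → (∀ i → j ≢ i → f i ≡ g i) →
  sumFin k f + g j ≡ sumFin k g + f j
sumFin-differ-at (suc k) f g zero agree = begin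
  f zero + S f + g zero    ≡⟨ cong (λ z → f zero + z + g zero) (sumFin-cong k (λ i → agree (suc i) (λ ()))) ⟩
  f zero + S g + g zero    ≡⟨ +-comm (f zero + S g) (g zero) ⟩
  g zero + (f zero + S g)  ≡⟨ cong (g zero +_) (+-comm (f zero) (S g)) ⟩
  g zero + (S g + f zero)  ≡⟨ +-assoc (g zero) (S g) (f zero) ⟨
  g zero + S g + f zero    ∎
  where
  open ≡-Reasoning
  S : (Fin (suc k) → ℕ) → ℕ
  S φ = sumFin k (λ i → φ (suc i))
sumFin-differ-at (suc k) f g (suc j) agree = begin
  f zero + S f + g (suc j)    ≡⟨ +-assoc (f zero) (S f) (g (suc j)) ⟩
  f zero + (S f + g (suc j))  ≡⟨ cong₂ _+_ (agree zero (λ ()))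
                                  (sumFin-differ-at k (λ i → f (suc i)) (λ i → g (suc i)) j
                                    (λ i j≢i → agree (suc i) (λ sj≡si → j≢i (fin-suc-injective sj≡si)))) ⟩
  g zero + (S g + f (suc j))  ≡⟨ +-assoc (g zero) (S g) (f (suc j)) ⟨
  g zero + S g + f (suc j)    ∎
  where
  open ≡-Reasoning
  S : (Fin (suc k) → ℕ) → ℕ
  S φ = sumFin k (λ i → φ (suc i))

toggle : ∀ {k} → (Fin k → Bool) → Fin k → Fin k → Bool
toggle X g h = if does (g ≟ h) then not (X h) else X h

toggle-here : ∀ {k} (X : Fin k → Bool) g → toggle X g g ≡ not (X g)
toggle-here X g with g ≟ g
... | yes _   = refl
... | no g≢g  = ⊥-elim (g≢g refl)

toggle-there : ∀ {k} (X : Fin k → Bool) {g h} → g ≢ h → toggle X g h ≡ X h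
toggle-there X {g} {h} g≢h with g ≟ h
... | yes g≡h = ⊥-elim (g≢h g≡h)
... | no _    = refl

sumFin-toggle : ∀ k (F : Fin k → Bool → ℕ) (X : Fin k → Bool) g →
  sumFin k (λ h → F h (toggle X g h)) + F g (X g) ≡ sumFin k (λ h → F h (X h)) + F g (not (X g))
sumFin-toggle k F X g =
  trans (sumFin-differ-at k _ _ g (λ h g≢h → cong (F h) (toggle-there X g≢h)))
        (cong (λ z → sumFin k (λ h → F h (X h)) + F g z) (toggle-here X g))

module _ (G : Graph) where

  degIn-local : ∀ (X Y : EdgeSet G) x → (∀ g → incident G x g ≡ true → X g ≡ Y g) →
    degIn G X x ≡ degIn G Y x
  degIn-local X Y x agree = sumFin-cong (m G) term
    where
    term : ∀ g → bit (X g ∧ incident G x g) ≡ bit (Y g ∧ incident G x g)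
    term g with incident G x g in ix
    ... | true  = cong (λ z → bit (z ∧ true)) (agree g ix)
    ... | false = cong bit (trans (∧-zeroʳ (X g)) (sym (∧-zeroʳ (Y g))))

  size-cong : ∀ (X Y : EdgeSet G) → (∀ g → X g ≡ Y g) → size G X ≡ size G Y
  size-cong X Y X≗Y = sumFin-cong (m G) (λ g → cong bit (X≗Y g))

  toggle-size : ∀ (X : EdgeSet G) g β → X g ≡ β → size G (toggle X g) + bit β ≡ size G X + bit (not β)
  toggle-size X g _ refl = sumFin-toggle (m G) (λ _ → bit) X g

  toggle-degIn : ∀ (X : EdgeSet G) g x β ι → X g ≡ β → incident G x g ≡ ι →
    degIn G (toggle X g) x + bit (β ∧ ι) ≡ degIn G X x + bit (not β ∧ ι)
  toggle-degIn X g x _ _ refl refl = sumFin-toggle (m G) (λ h β → bit (β ∧ incident G x h)) X g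

  add-size : ∀ (X : EdgeSet G) g → X g ≡ false → size G (toggle X g) ≡ suc (size G X)
  add-size X g Xg = trans (sym (+-identityʳ _)) (trans (toggle-size X g false Xg) (+-comm _ 1))

  remove-size : ∀ (X : EdgeSet G) g → X g ≡ true → suc (size G (toggle X g)) ≡ size G X
  remove-size X g Xg = trans (+-comm 1 _) (trans (toggle-size X g true Xg) (+-identityʳ _))

  add-degIn : ∀ (X : EdgeSet G) g x → X g ≡ false → incident G x g ≡ true →
    degIn G (toggle X g) x ≡ suc (degIn G X x)
  add-degIn X g x Xg ix = trans (sym (+-identityʳ _)) (trans (toggle-degIn X g x false true Xg ix) (+-comm _ 1))

  remove-degIn : ∀ (X : EdgeSet G) g x → X g ≡ true → incident G x g ≡ true →
    suc (degIn G (toggle X g) x) ≡ degIn G X x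
  remove-degIn X g x Xg ix = trans (+-comm 1 _) (trans (toggle-degIn X g x true true Xg ix) (+-identityʳ _))

  toggle-away : ∀ (X : EdgeSet G) g x → incident G x g ≡ false → degIn G (toggle X g) x ≡ degIn G X x
  toggle-away X g x ix = degIn-local _ _ x λ h ih → toggle-there X {g} {h} λ { refl → true-false ih ix }

  double-count : (∀ g → proj₁ (ends G g) ≢ proj₂ (ends G g)) → ∀ (w : Fin (n G) → Bool) (X : EdgeSet G) →
    sumFin (n G) (λ x → bit (w x) * degIn G X x) ≡
    sumFin (m G) (λ g → bit (X g) * (bit (w (proj₁ (ends G g))) + bit (w (proj₂ (ends G g)))))
  double-count loopless w X = begin
    sumFin (n G) (λ x → bit (w x) * degIn G X x)
      ≡⟨ sumFin-cong (n G) (λ x → sumFin-*ˡ (m G) (bit (w x)) _) ⟨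
    sumFin (n G) (λ x → sumFin (m G) (λ g → bit (w x) * bit (X g ∧ incident G x g)))
      ≡⟨ sumFin-swap (n G) (m G) _ ⟩
    sumFin (m G) (λ g → sumFin (n G) (λ x → bit (w x) * bit (X g ∧ incident G x g)))
      ≡⟨ sumFin-cong (m G) edgeTerm ⟩
    sumFin (m G) (λ g → bit (X g) * (bit (w (proj₁ (ends G g))) + bit (w (proj₂ (ends G g))))) ∎
    where
    open ≡-Reasoning
    -- The two (distinct) ends of `g` are the only vertices incident with it.
    incidences : ∀ g → sumFin (n G) (λ x → bit (w x) * bit (incident G x g)) ≡
                        bit (w (proj₁ (ends G g))) + bit (w (proj₂ (ends G g)))
    incidences g = begin
      sumFin (n G) (λ x → bit (w x) * bit (incident G x g))
        ≡⟨ sumFin-cong (n G) split ⟩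
      sumFin (n G) (λ x → bit (w x) * bit (does (p ≟ x)) + bit (w x) * bit (does (q ≟ x)))
        ≡⟨ sumFin-+ (n G) _ _ ⟩
      sumFin (n G) (λ x → bit (w x) * bit (does (p ≟ x))) + sumFin (n G) (λ x → bit (w x) * bit (does (q ≟ x)))
        ≡⟨ cong₂ _+_ (sumFin-indicator (n G) (λ x → bit (w x)) p) (sumFin-indicator (n G) (λ x → bit (w x)) q) ⟩
      bit (w p) + bit (w q) ∎
      where
      p = proj₁ (ends G g)
      q = proj₂ (ends G g)
      split : ∀ x → bit (w x) * bit (incident G x g) ≡ bit (w x) * bit (does (p ≟ x)) + bit (w x) * bit (does (q ≟ x))
      split x with p ≟ x | q ≟ x
      ... | yes p≡x | yes q≡x = ⊥-elim (loopless g (trans p≡x (sym q≡x)))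
      ... | yes _   | no _    = sym (trans (cong (bit (w x) * 1 +_) (*-zeroʳ (bit (w x)))) (+-identityʳ _))
      ... | no _    | yes _   = sym (cong (_+ bit (w x) * 1) (*-zeroʳ (bit (w x))))
      ... | no _    | no _    = sym (cong₂ _+_ (*-zeroʳ (bit (w x))) refl)
    edgeTerm : ∀ g → sumFin (n G) (λ x → bit (w x) * bit (X g ∧ incident G x g)) ≡
                     bit (X g) * (bit (w (proj₁ (ends G g))) + bit (w (proj₂ (ends G g))))
    edgeTerm g with X g
    ... | true  = trans (incidences g) (sym (+-identityʳ _))
    ... | false = sumFin-zero (n G) (λ x → *-zeroʳ (bit (w x)))

-- A proper 2-colouring `c` orients every edge from its end of colour `true` (side A)
-- to its end of colour `false` (side B).
module Bipartition (G : Graph) (c : Fin (n G) → Bool)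
                   (proper : ∀ g → c (proj₁ (ends G g)) ≢ c (proj₂ (ends G g))) where

  end₁ end₂ : Fin (m G) → Fin (n G)
  end₁ g = proj₁ (ends G g)
  end₂ g = proj₂ (ends G g)

  loopless : ∀ g → end₁ g ≢ end₂ g
  loopless g ends≡ = proper g (cong c ends≡)

  aEnd bEnd : Fin (m G) → Fin (n G)
  aEnd g = if c (end₁ g) then end₁ g else end₂ g
  bEnd g = if c (end₁ g) then end₂ g else end₁ g

  colour₂ : ∀ g → c (end₂ g) ≡ not (c (end₁ g))
  colour₂ g = ¬-not (λ eq → proper g (sym eq))

  aEnd-colour : ∀ g → c (aEnd g) ≡ true
  aEnd-colour g with c (end₁ g) in c₁
  ... | true  = c₁
  ... | false = trans (colour₂ g) (cong not c₁)

  bEnd-colour : ∀ g → c (bEnd g) ≡ false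
  bEnd-colour g with c (end₁ g) in c₁
  ... | true  = trans (colour₂ g) (cong not c₁)
  ... | false = c₁

  ends-oriented : ∀ g → (end₁ g ≡ aEnd g × end₂ g ≡ bEnd g) ⊎ (end₁ g ≡ bEnd g × end₂ g ≡ aEnd g)
  ends-oriented g with c (end₁ g)
  ... | true  = inj₁ (refl , refl)
  ... | false = inj₂ (refl , refl)

  incident-end₁ : ∀ g → incident G (end₁ g) g ≡ true
  incident-end₁ g with end₁ g ≟ end₁ g
  ... | yes _    = refl
  ... | no ≢refl = ⊥-elim (≢refl refl)

  incident-end₂ : ∀ g → incident G (end₂ g) g ≡ true
  incident-end₂ g with end₂ g ≟ end₂ g
  ... | yes _    = ∨-zeroʳ _
  ... | no ≢refl = ⊥-elim (≢refl refl)

  incident-aEnd : ∀ g → incident G (aEnd g) g ≡ true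
  incident-aEnd g with c (end₁ g)
  ... | true  = incident-end₁ g
  ... | false = incident-end₂ g

  incident-bEnd : ∀ g → incident G (bEnd g) g ≡ true
  incident-bEnd g with c (end₁ g)
  ... | true  = incident-end₂ g
  ... | false = incident-end₁ g

  incident-ends : ∀ x g → incident G x g ≡ true → x ≡ aEnd g ⊎ x ≡ bEnd g
  incident-ends x g ix with end₁ g ≟ x | end₂ g ≟ x | c (end₁ g)
  ... | yes refl | _        | true  = inj₁ refl
  ... | yes refl | _        | false = inj₂ refl
  ... | no _     | yes refl | true  = inj₂ refl
  ... | no _     | yes refl | false = inj₁ refl
  ... | no _     | no _     | _     with () ← ix

  incident-away : ∀ x g → x ≢ aEnd g → x ≢ bEnd g → incident G x g ≡ false
  incident-away x g x≢a x≢b with incident G x g in ix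
  ... | false = refl
  ... | true  with incident-ends x g ix
  ...   | inj₁ x≡a = ⊥-elim (x≢a x≡a)
  ...   | inj₂ x≡b = ⊥-elim (x≢b x≡b)

  incident-A : ∀ x g → c x ≡ true → incident G x g ≡ true → x ≡ aEnd g
  incident-A x g cx ix with incident-ends x g ix
  ... | inj₁ x≡a = x≡a
  ... | inj₂ refl with () ← trans (sym cx) (bEnd-colour g)

  oriented-count : ∀ (w : Fin (n G) → Bool) (X : EdgeSet G) →
    sumFin (n G) (λ x → bit (w x) * degIn G X x) ≡
    sumFin (m G) (λ g → bit (X g) * (bit (w (aEnd g)) + bit (w (bEnd g))))
  oriented-count w X = trans (double-count G loopless w X) (sumFin-cong (m G) λ g → cong (bit (X g) *_) (orient g))
    where
    orient : ∀ g → bit (w (end₁ g)) + bit (w (end₂ g)) ≡ bit (w (aEnd g)) + bit (w (bEnd g))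
    orient g with ends-oriented g
    ... | inj₁ (e₁ , e₂) = cong₂ (λ u v → bit (w u) + bit (w v)) e₁ e₂
    ... | inj₂ (e₁ , e₂) = trans (cong₂ (λ u v → bit (w u) + bit (w v)) e₁ e₂) (+-comm (bit (w (bEnd g))) _)

  count-A : ∀ (w : Fin (n G) → Bool) (X : EdgeSet G) →
    sumFin (n G) (λ x → bit (c x ∧ w x) * degIn G X x) ≡ sumFin (m G) (λ g → bit (X g) * bit (w (aEnd g)))
  count-A w X = trans (oriented-count (λ x → c x ∧ w x) X) (sumFin-cong (m G) λ g → cong (bit (X g) *_)
    (trans (cong₂ (λ u v → bit (u ∧ w (aEnd g)) + bit (v ∧ w (bEnd g))) (aEnd-colour g) (bEnd-colour g)) (+-identityʳ _)))

  count-B : ∀ (w : Fin (n G) → Bool) (X : EdgeSet G) →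
    sumFin (n G) (λ x → bit (not (c x) ∧ w x) * degIn G X x) ≡ sumFin (m G) (λ g → bit (X g) * bit (w (bEnd g)))
  count-B w X = trans (oriented-count (λ x → not (c x) ∧ w x) X) (sumFin-cong (m G) λ g → cong (bit (X g) *_)
    (cong₂ (λ u v → bit (not u ∧ w (aEnd g)) + bit (not v ∧ w (bEnd g))) (aEnd-colour g) (bEnd-colour g)))

-- The nodes of a residual digraph: the vertices of the graph, a source `src` attached
-- to side A and a sink `snk` attached to side B.
data Node (k : ℕ) : Set where
  vtx     : Fin k → Node k
  src snk : Node k

vtx-injective : ∀ {k} {x y : Fin k} → vtx x ≡ vtx y → x ≡ y
vtx-injective refl = refl

_≟ᴺ_ : ∀ {k} → DecidableEquality (Node k)
vtx x ≟ᴺ vtx y with x ≟ y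
... | yes refl = yes refl
... | no x≢y   = no (λ eq → x≢y (vtx-injective eq))
vtx _ ≟ᴺ src   = no (λ ())
vtx _ ≟ᴺ snk   = no (λ ())
src   ≟ᴺ vtx _ = no (λ ())
src   ≟ᴺ src   = yes refl
src   ≟ᴺ snk   = no (λ ())
snk   ≟ᴺ vtx _ = no (λ ())
snk   ≟ᴺ src   = no (λ ())
snk   ≟ᴺ snk   = yes refl

Distinct : ∀ {A : Set} → List A → Set
Distinct []       = ⊤
Distinct (x ∷ xs) = x ∉ xs × Distinct xs

module Residual (G : Graph) (c : Fin (n G) → Bool)
                (proper : ∀ g → c (proj₁ (ends G g)) ≢ c (proj₂ (ends G g)))
                (b : Fin (n G) → ℕ) (M : EdgeSet G) where

  open Bipartition G c proper
  open import Data.List.Membership.DecPropositional (_≟ᴺ_ {n G}) using (_∈?_)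

  -- Cycles of D(M) are the ways of exchanging edges of M
  -- without losing size.
  data Arc : Node (n G) → Node (n G) → Set where
    fwd   : ∀ g → M g ≡ false → Arc (vtx (aEnd g)) (vtx (bEnd g))
    bwd   : ∀ g → M g ≡ true → Arc (vtx (bEnd g)) (vtx (aEnd g))
    toS   : ∀ {x} → c x ≡ true → Arc (vtx x) src
    fromS : ∀ {x} → c x ≡ true → degIn G M x < b x → Arc src (vtx x)
    toT   : ∀ {x} → c x ≡ false → degIn G M x < b x → Arc (vtx x) snk
    fromT : ∀ {x} → c x ≡ false → Arc snk (vtx x)

  Path : Node (n G) → Node (n G) → Set
  Path = Star Arc

  arcTail arcHead : Fin (m G) → Fin (n G)
  arcTail g = if M g then bEnd g else aEnd g
  arcHead g = if M g then aEnd g else bEnd g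

  edgeArc : ∀ g → Arc (vtx (arcTail g)) (vtx (arcHead g))
  edgeArc g with M g in Mg
  ... | true  = bwd g Mg
  ... | false = fwd g Mg

  arcHead-matched : ∀ g → M g ≡ true → arcHead g ≡ aEnd g
  arcHead-matched g Mg = cong (λ z → if z then aEnd g else bEnd g) Mg

  arcHead-unmatched : ∀ g → M g ≡ false → arcHead g ≡ bEnd g
  arcHead-unmatched g Mg = cong (λ z → if z then aEnd g else bEnd g) Mg

  _⇄_ : Node (n G) → Node (n G) → Set
  x ⇄ y = Path x y × Path y x

  ⇄-sym : ∀ {x y} → x ⇄ y → y ⇄ x
  ⇄-sym (forth , back) = back , forth

  ⇄-trans : ∀ {x y z} → x ⇄ y → y ⇄ z → x ⇄ z
  ⇄-trans (xy , yx) (yz , zy) = xy ◅◅ yz , zy ◅◅ yx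

  entered : ∀ {x y} → Path x y → List (Node (n G))
  entered ε                   = []
  entered (_◅_ {j = j} _ rest) = j ∷ entered rest

  SimplePath : Node (n G) → Node (n G) → Set
  SimplePath x y = Σ (Path x y) λ p → Distinct (x ∷ entered p)

  simplify : ∀ {x y} → Path x y → SimplePath x y
  simplify ε = ε , ((λ ()) , tt)
  simplify {x} (_◅_ {j = j} a rest) with simplify rest
  ... | p , distinct with x ∈? (j ∷ entered p)
  ...   | yes x∈p = cutAt p distinct x∈p
    where
    cutAt : ∀ {j y} (p : Path j y) → Distinct (j ∷ entered p) → x ∈ (j ∷ entered p) → SimplePath x y
    cutAt p       distinct        (here refl) = p , distinct
    cutAt (_ ◅ p) (_ , distinct)  (there x∈p) = cutAt p distinct x∈p
  ...   | no x∉p  = (a ◅ p) , (x∉p , distinct)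

  -- Exchanging M along a cycle of D(M) through the arc of `e`: start from N₀, which is M
  -- with `e` toggled, at the head `s` of that arc, walk a simple path back to its tail
  -- `t`, and toggle every edge whose arc is traversed.  Meanwhile only the current node
  -- and `t` (whose degree changed with `e`) may exceed their degree bounds, in the
  -- controlled way recorded by `AtNode`, `credit` and `debit`.
  module Exchange (M-bounded : IsBMatching G b M) (e : Fin (m G)) where

    s t : Fin (n G)
    s = arcHead e
    t = arcTail e

    N₀ : EdgeSet G
    N₀ = toggle M e

    -- Adding `e` raises the degree of its A-end `t` by one (recorded as `credit`);
    -- removing `e` lowers the degree of its B-end `t` by one (recorded as `debit`).
    credit debit : Fin (n G) → ℕ
    credit y = bit (not (M e) ∧ (c y ∧ incident G y e))
    debit  y = bit (M e ∧ (not (c y) ∧ incident G y e))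

    credit-B : ∀ y → c y ≡ false → credit y ≡ 0
    credit-B y cy = trans (cong (λ z → bit (not (M e) ∧ (z ∧ incident G y e))) cy) (cong bit (∧-zeroʳ (not (M e))))

    debit-A : ∀ y → c y ≡ true → debit y ≡ 0
    debit-A y cy = trans (cong (λ z → bit (M e ∧ (not z ∧ incident G y e))) cy) (cong bit (∧-zeroʳ (M e)))

    end-side : ∀ y → y ≢ s → incident G y e ≡ true → c y ≡ not (M e)
    end-side y y≢s iy with M e | incident-ends y e iy
    ... | true  | inj₁ refl = ⊥-elim (y≢s refl)
    ... | true  | inj₂ refl = bEnd-colour e
    ... | false | inj₁ refl = aEnd-colour e
    ... | false | inj₂ refl = ⊥-elim (y≢s refl)

    fresh : ∀ y → y ≢ s → degIn G N₀ y + debit y ≡ degIn G M y + credit y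
    fresh y y≢s = begin
      degIn G N₀ y + debit y                          ≡⟨ cong (degIn G N₀ y +_) debit≡ ⟨
      degIn G N₀ y + bit (M e ∧ incident G y e)       ≡⟨ toggle-degIn G M e y _ _ refl refl ⟩
      degIn G M y + bit (not (M e) ∧ incident G y e)  ≡⟨ cong (degIn G M y +_) credit≡ ⟩
      degIn G M y + credit y                          ∎
      where
      open ≡-Reasoning
      debit≡ : bit (M e ∧ incident G y e) ≡ debit y
      debit≡ = cong bit (∧-absorb (M e) _ _ λ Me iy →
                 trans (cong not (end-side y y≢s iy)) (trans (not-involutive (M e)) Me))
      credit≡ : bit (not (M e) ∧ incident G y e) ≡ credit y
      credit≡ = cong bit (∧-absorb (not (M e)) _ _ λ ¬Me iy → trans (end-side y y≢s iy) ¬Me)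

    -- On the A side of the walk (src included) the current edge set has the size of M,
    -- less one if `e` was removed; on the B side (snk included) it has one edge more.
    SizeA SizeB : EdgeSet G → Set
    SizeA N = size G N + bit (M e) ≡ size G M
    SizeB N = size G N + bit (M e) ≡ suc (size G M)

    -- The bound at the current node: an A-vertex has room for one more edge, a B-vertex
    -- carries at most one edge more than in M.
    AtNode : Node (n G) → EdgeSet G → Set
    AtNode (vtx x) N = (c x ≡ true → suc (degIn G N x) ≤ b x + credit x × SizeA N)
                     × (c x ≡ false → degIn G N x + debit x ≤ suc (degIn G M x) × SizeB N)
    AtNode src     N = SizeA N
    AtNode snk     N = SizeB N

    record Invariant {w : Node (n G)} (rest : Path w (vtx t)) (N : EdgeSet G) : Set where
      field
        distinct  : Distinct (w ∷ entered rest)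
        startLeft : vtx s ∉ entered rest
        atCurrent : AtNode w N
        elsewhere : ∀ x → vtx x ≢ w → degIn G N x ≤ b x + credit x
        untouched : ∀ g y → incident G y g ≡ true → vtx y ∈ entered rest → N g ≡ N₀ g
        keepsE    : N e ≡ N₀ e

    unvisited : ∀ {w} {rest : Path w (vtx t)} {N} → Invariant rest N → ∀ y → vtx y ∈ entered rest →
      degIn G N y + debit y ≡ degIn G M y + credit y
    unvisited {N = N} inv y y∈rest = begin
      degIn G N y + debit y   ≡⟨ cong (_+ debit y) (degIn-local G N N₀ y (λ g iy → untouched g y iy y∈rest)) ⟩
      degIn G N₀ y + debit y  ≡⟨ fresh y (λ { refl → startLeft y∈rest }) ⟩
      degIn G M y + credit y  ∎
      where
      open ≡-Reasoning
      open Invariant inv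

    pass : ∀ {w j} {a : Arc w j} {rest : Path j (vtx t)} {N} → Invariant (a ◅ rest) N →
      AtNode j N → (∀ x → vtx x ≢ j → degIn G N x ≤ b x + credit x) → Invariant rest N
    pass inv atNext elsewhere′ = record
      { distinct  = proj₂ distinct
      ; startLeft = λ s∈rest → startLeft (there s∈rest)
      ; atCurrent = atNext
      ; elsewhere = elsewhere′
      ; untouched = λ g y iy y∈rest → untouched g y iy (there y∈rest)
      ; keepsE    = keepsE
      }
      where open Invariant inv

    -- A step along the arc of an edge `g` from `x` to `y` toggles `g`; this edge is not
    -- `e` (whose arc enters the start) and has not been toggled before.
    passEdge : ∀ {x y} {a : Arc (vtx x) (vtx y)} {rest : Path (vtx y) (vtx t)} {N} g →
      (∀ z → incident G z g ≡ true → z ≡ x ⊎ z ≡ y) → g ≢ e → Invariant (a ◅ rest) N →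
      AtNode (vtx y) (toggle N g) → (∀ z → vtx z ≢ vtx y → degIn G (toggle N g) z ≤ b z + credit z) →
      Invariant rest (toggle N g)
    passEdge {x} {y} {rest = rest} {N} g ends-g g≢e inv atNext elsewhere′ = record
      { distinct  = proj₂ distinct
      ; startLeft = λ s∈rest → startLeft (there s∈rest)
      ; atCurrent = atNext
      ; elsewhere = elsewhere′
      ; untouched = untouched′
      ; keepsE    = trans (toggle-there N g≢e) keepsE
      }
      where
      open Invariant inv
      untouched′ : ∀ h z → incident G z h ≡ true → vtx z ∈ entered rest → toggle N g h ≡ N₀ h
      untouched′ h z iz z∈rest with g ≟ h
      ... | no _ = untouched h z iz (there z∈rest)
      ... | yes refl with ends-g z iz
      ...   | inj₁ refl = ⊥-elim (proj₁ distinct (there z∈rest))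
      ...   | inj₂ refl = ⊥-elim (proj₁ (proj₂ distinct) z∈rest)

    step-fwd : ∀ g (Mg : M g ≡ false) {rest : Path (vtx (bEnd g)) (vtx t)} {N} →
      Invariant (fwd g Mg ◅ rest) N → Invariant rest (toggle N g)
    step-fwd g Mg {N = N} inv = passEdge g (λ z iz → incident-ends z g iz) g≢e inv atNext elsewhere′
      where
      open Invariant inv
      a = aEnd g
      bb = bEnd g
      g≢e : g ≢ e
      g≢e refl = startLeft (here (cong vtx (arcHead-unmatched e Mg)))
      Ng : N g ≡ false
      Ng = trans (untouched g bb (incident-bEnd g) (here refl)) (trans (toggle-there M (λ e≡g → g≢e (sym e≡g))) Mg)
      atA = proj₁ atCurrent (aEnd-colour g)
      loadB : degIn G (toggle N g) bb + debit bb ≡ suc (degIn G M bb)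
      loadB = begin
        degIn G (toggle N g) bb + debit bb  ≡⟨ cong (_+ debit bb) (add-degIn G N g bb Ng (incident-bEnd g)) ⟩
        suc (degIn G N bb + debit bb)       ≡⟨ cong suc (unvisited inv bb (here refl)) ⟩
        suc (degIn G M bb + credit bb)      ≡⟨ cong (λ z → suc (degIn G M bb + z)) (credit-B bb (bEnd-colour g)) ⟩
        suc (degIn G M bb + 0)              ≡⟨ cong suc (+-identityʳ _) ⟩
        suc (degIn G M bb)                  ∎
        where open ≡-Reasoning
      atNext : AtNode (vtx bb) (toggle N g)
      atNext = (λ ct → true-false ct (bEnd-colour g))
             , (λ _ → ≤-reflexive loadB , trans (cong (_+ bit (M e)) (add-size G N g Ng)) (cong suc (proj₂ atA)))
      elsewhere′ : ∀ z → vtx z ≢ vtx bb → degIn G (toggle N g) z ≤ b z + credit z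
      elsewhere′ z z≢b with z ≟ a
      ... | yes refl = ≤-trans (≤-reflexive (add-degIn G N g a Ng (incident-aEnd g))) (proj₁ atA)
      ... | no z≢a   = ≤-trans (≤-reflexive (toggle-away G N g z (incident-away z g z≢a (λ eq → z≢b (cong vtx eq)))))
                               (elsewhere z (λ eq → z≢a (vtx-injective eq)))

    step-bwd : ∀ g (Mg : M g ≡ true) {rest : Path (vtx (aEnd g)) (vtx t)} {N} →
      Invariant (bwd g Mg ◅ rest) N → Invariant rest (toggle N g)
    step-bwd g Mg {N = N} inv =
      passEdge g (λ z iz → swap (incident-ends z g iz)) g≢e inv atNext elsewhere′
      where
      open Invariant inv
      a = aEnd g
      bb = bEnd g
      g≢e : g ≢ e
      g≢e refl = startLeft (here (cong vtx (arcHead-matched e Mg)))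
      Ng : N g ≡ true
      Ng = trans (untouched g a (incident-aEnd g) (here refl)) (trans (toggle-there M (λ e≡g → g≢e (sym e≡g))) Mg)
      atB = proj₂ atCurrent (bEnd-colour g)
      roomA : suc (degIn G (toggle N g) a) ≤ b a + credit a
      roomA = begin
        suc (degIn G (toggle N g) a)  ≡⟨ remove-degIn G N g a Ng (incident-aEnd g) ⟩
        degIn G N a                   ≡⟨ +-identityʳ _ ⟨
        degIn G N a + 0               ≡⟨ cong (degIn G N a +_) (debit-A a (aEnd-colour g)) ⟨
        degIn G N a + debit a         ≡⟨ unvisited inv a (here refl) ⟩
        degIn G M a + credit a        ≤⟨ +-monoˡ-≤ (credit a) (M-bounded a) ⟩
        b a + credit a                ∎
        where open ≤-Reasoning
      atNext : AtNode (vtx a) (toggle N g)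
      atNext = (λ _ → roomA , suc-injective (trans (cong (_+ bit (M e)) (remove-size G N g Ng)) (proj₂ atB)))
             , (λ cf → true-false (aEnd-colour g) cf)
      elsewhere′ : ∀ z → vtx z ≢ vtx a → degIn G (toggle N g) z ≤ b z + credit z
      elsewhere′ z z≢a with z ≟ bb
      ... | yes refl = begin
        degIn G (toggle N g) bb  ≤⟨ ≤-pred (begin
          suc (degIn G (toggle N g) bb)  ≡⟨ remove-degIn G N g bb Ng (incident-bEnd g) ⟩
          degIn G N bb                   ≤⟨ m≤m+n _ _ ⟩
          degIn G N bb + debit bb        ≤⟨ proj₁ atB ⟩
          suc (degIn G M bb)             ∎) ⟩
        degIn G M bb                     ≤⟨ M-bounded bb ⟩
        b bb                             ≤⟨ m≤m+n _ _ ⟩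
        b bb + credit bb                 ∎
        where open ≤-Reasoning
      ... | no z≢b   = ≤-trans (≤-reflexive (toggle-away G N g z (incident-away z g (λ eq → z≢a (cong vtx eq)) z≢b)))
                               (elsewhere z (λ eq → z≢b (vtx-injective eq)))

    step-toS : ∀ {x} (cx : c x ≡ true) {rest : Path src (vtx t)} {N} →
      Invariant (toS cx ◅ rest) N → Invariant rest N
    step-toS {x} cx {N = N} inv = pass inv (proj₂ atA) elsewhere′
      where
      open Invariant inv
      atA = proj₁ atCurrent cx
      elsewhere′ : ∀ z → vtx z ≢ src → degIn G N z ≤ b z + credit z
      elsewhere′ z _ with z ≟ x
      ... | yes refl = ≤-trans (n≤1+n _) (proj₁ atA)
      ... | no z≢x   = elsewhere z (λ eq → z≢x (vtx-injective eq))

    step-fromS : ∀ {x} (cx : c x ≡ true) (lt : degIn G M x < b x) {rest : Path (vtx x) (vtx t)} {N} →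
      Invariant (fromS cx lt ◅ rest) N → Invariant rest N
    step-fromS {x} cx lt {N = N} inv = pass inv ((λ _ → roomA , atCurrent) , (λ cf → true-false cx cf))
                                               (λ z _ → elsewhere z (λ ()))
      where
      open Invariant inv
      roomA : suc (degIn G N x) ≤ b x + credit x
      roomA = begin
        suc (degIn G N x)           ≡⟨ cong suc (+-identityʳ _) ⟨
        suc (degIn G N x + 0)       ≡⟨ cong (λ z → suc (degIn G N x + z)) (debit-A x cx) ⟨
        suc (degIn G N x + debit x) ≡⟨ cong suc (unvisited inv x (here refl)) ⟩
        suc (degIn G M x) + credit x ≤⟨ +-monoˡ-≤ (credit x) lt ⟩
        b x + credit x              ∎
        where open ≤-Reasoning

    step-toT : ∀ {x} (cx : c x ≡ false) (lt : degIn G M x < b x) {rest : Path snk (vtx t)} {N} →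
      Invariant (toT cx lt ◅ rest) N → Invariant rest N
    step-toT {x} cx lt {N = N} inv = pass inv (proj₂ atB) elsewhere′
      where
      open Invariant inv
      atB = proj₂ atCurrent cx
      elsewhere′ : ∀ z → vtx z ≢ snk → degIn G N z ≤ b z + credit z
      elsewhere′ z _ with z ≟ x
      ... | yes refl = begin
        degIn G N x             ≤⟨ m≤m+n _ _ ⟩
        degIn G N x + debit x   ≤⟨ proj₁ atB ⟩
        suc (degIn G M x)       ≤⟨ lt ⟩
        b x                     ≤⟨ m≤m+n _ _ ⟩
        b x + credit x          ∎
        where open ≤-Reasoning
      ... | no z≢x   = elsewhere z (λ eq → z≢x (vtx-injective eq))

    step-fromT : ∀ {x} (cx : c x ≡ false) {rest : Path (vtx x) (vtx t)} {N} →
      Invariant (fromT cx ◅ rest) N → Invariant rest N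
    step-fromT {x} cx {N = N} inv = pass inv ((λ ct → true-false ct cx) , (λ _ → loadB , atCurrent))
                                            (λ z _ → elsewhere z (λ ()))
      where
      open Invariant inv
      loadB : degIn G N x + debit x ≤ suc (degIn G M x)
      loadB = begin
        degIn G N x + debit x   ≡⟨ unvisited inv x (here refl) ⟩
        degIn G M x + credit x  ≡⟨ cong (degIn G M x +_) (credit-B x cx) ⟩
        degIn G M x + 0         ≡⟨ +-identityʳ _ ⟩
        degIn G M x             ≤⟨ n≤1+n _ ⟩
        suc (degIn G M x)       ∎
        where open ≤-Reasoning

    walk : ∀ {w} (rest : Path w (vtx t)) N → Invariant rest N → Σ (EdgeSet G) (Invariant {vtx t} ε)
    walk ε                      N inv = N , inv
    walk (fwd g Mg     ◅ rest)  N inv = walk rest (toggle N g) (step-fwd g Mg inv)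
    walk (bwd g Mg     ◅ rest)  N inv = walk rest (toggle N g) (step-bwd g Mg inv)
    walk (toS cx       ◅ rest)  N inv = walk rest N (step-toS cx inv)
    walk (fromS cx lt  ◅ rest)  N inv = walk rest N (step-fromS cx lt inv)
    walk (toT cx lt    ◅ rest)  N inv = walk rest N (step-toT cx lt inv)
    walk (fromT cx     ◅ rest)  N inv = walk rest N (step-fromT cx inv)

    start : (p : Path (vtx s) (vtx t)) → Distinct (vtx s ∷ entered p) → Invariant p N₀
    start p distinct = record
      { distinct  = distinct
      ; startLeft = proj₁ distinct
      ; atCurrent = atStart
      ; elsewhere = λ x x≢s → begin
          degIn G N₀ x             ≤⟨ m≤m+n _ _ ⟩
          degIn G N₀ x + debit x   ≡⟨ fresh x (λ eq → x≢s (cong vtx eq)) ⟩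
          degIn G M x + credit x   ≤⟨ +-monoˡ-≤ (credit x) (M-bounded x) ⟩
          b x + credit x           ∎
      ; untouched = λ _ _ _ _ → refl
      ; keepsE    = refl
      }
      where
      open ≤-Reasoning
      atStart : AtNode (vtx s) N₀
      atStart with M e in Me
      ... | true  = (λ _ → ≤-trans (≤-reflexive (remove-degIn G M e (aEnd e) Me (incident-aEnd e)))
                                   (≤-trans (M-bounded (aEnd e)) (m≤m+n _ _))
                         , trans (+-comm _ 1) (remove-size G M e Me))
                  , (λ cf → true-false (aEnd-colour e) cf)
      ... | false = (λ ct → true-false ct (bEnd-colour e))
                  , (λ _ → ≤-reflexive (trans (+-identityʳ _) (add-degIn G M e (bEnd e) Me (incident-bEnd e)))
                         , trans (+-identityʳ _) (add-size G M e Me))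

    credit-away : ∀ x → x ≢ t → credit x ≡ 0
    credit-away x x≢t with M e | c x in cx | incident G x e in ix
    ... | true  | _     | _     = refl
    ... | false | false | _     = refl
    ... | false | true  | false = refl
    ... | false | true  | true  = ⊥-elim (x≢t (incident-A x e cx ix))

    closes : ∀ {N} → AtNode (vtx t) N → degIn G N t ≤ b t × size G N ≡ size G M
    closes {N} at with M e
    ... | true  = ≤-pred (≤-trans (≤-reflexive (+-comm 1 _)) (≤-trans (≤-reflexive (cong (degIn G N (bEnd e) +_) (sym debit≡1)))
                    (≤-trans (proj₁ atB) (s≤s (M-bounded (bEnd e))))))
                , suc-injective (trans (+-comm 1 _) (proj₂ atB))
      where
      atB = proj₂ at (bEnd-colour e)
      debit≡1 : bit (not (c (bEnd e)) ∧ incident G (bEnd e) e) ≡ 1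
      debit≡1 = cong₂ (λ u v → bit (not u ∧ v)) (bEnd-colour e) (incident-bEnd e)
    ... | false = ≤-pred (≤-trans (proj₁ atA) (≤-reflexive (trans (cong (b (aEnd e) +_) credit≡1) (+-comm _ 1))))
                , trans (sym (+-identityʳ _)) (proj₂ atA)
      where
      atA = proj₁ at (aEnd-colour e)
      credit≡1 : bit (c (aEnd e) ∧ incident G (aEnd e) e) ≡ 1
      credit≡1 = cong₂ (λ u v → bit (u ∧ v)) (aEnd-colour e) (incident-aEnd e)

    finish : IsMaxBMatching G b M → ∀ {N} → Invariant {vtx t} ε N → IsMaxBMatching G b N × N e ≡ not (M e)
    finish maxM {N} inv = (bounded , maximum) , trans keepsE (toggle-here M e)
      where
      open Invariant inv
      bounded : IsBMatching G b N
      bounded x with x ≟ t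
      ... | yes refl = proj₁ (closes atCurrent)
      ... | no x≢t   = ≤-trans (elsewhere x (λ eq → x≢t (vtx-injective eq)))
                               (≤-reflexive (trans (cong (b x +_) (credit-away x x≢t)) (+-identityʳ _)))
      maximum : ∀ M′ → IsBMatching G b M′ → size G M′ ≤ size G N
      maximum M′ bounded′ = ≤-trans (proj₂ maxM M′ bounded′) (≤-reflexive (sym (proj₂ (closes atCurrent))))

  exchange : IsMaxBMatching G b M → ∀ e → Path (vtx (arcHead e)) (vtx (arcTail e)) →
    Σ (EdgeSet G) λ N → IsMaxBMatching G b N × N e ≡ not (M e)
  exchange maxM e back =
    let open Exchange (proj₁ maxM) e
        (p , distinct) = simplify back
        (N , inv) = walk p N₀ (start p distinct)
    in N , finish maxM inv

-- The contribution of one edge to the counts of the cut lemma, for an edge of status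
-- `μ` in M and `ν` in N whose A-end and B-end have membership `α` and `β` in a set
-- closed under its arc.
edge-balance : ∀ μ ν α β → (μ ≡ false → α ≡ true → β ≡ true) → (μ ≡ true → β ≡ true → α ≡ true) →
  bit ν * bit α + bit μ * bit β ≤ bit μ * bit α + bit ν * bit β
edge-balance false false _     _     _   _   = ≤-refl
edge-balance true  true  _     _     _   _   = ≤-refl
edge-balance false true  false _     _   _   = z≤n
edge-balance false true  true  true  _   _   = ≤-refl
edge-balance false true  true  false fwd _   = true-false (fwd refl refl) refl
edge-balance true  false _     false _   _   = z≤n
edge-balance true  false true  true  _   _   = ≤-refl
edge-balance true  false false true  _   bwd = true-false (bwd refl refl) refl

-- An edge of M △ N whose arc enters the set (tail outside, head inside) counts strictly.
edge-leaving : ∀ μ ν α β → μ ≢ ν → α ≡ μ → β ≡ not μ →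
  bit ν * bit α + bit μ * bit β < bit μ * bit α + bit ν * bit β
edge-leaving false false _ _ μ≢ν _    _    = ⊥-elim (μ≢ν refl)
edge-leaving true  true  _ _ μ≢ν _    _    = ⊥-elim (μ≢ν refl)
edge-leaving false true  _ _ _   refl refl = s≤s z≤n
edge-leaving true  false _ _ _   refl refl = s≤s z≤n

-- Counting the edges of M and N with an end in S, the A-ends can only gain
-- and the B-ends only lose in passing from M to N, while every edge contributes a
-- balance in the opposite direction, strictly so for an entering edge.
module Cut (G : Graph) (c : Fin (n G) → Bool)
           (proper : ∀ g → c (proj₁ (ends G g)) ≢ c (proj₂ (ends G g)))
           (b : Fin (n G) → ℕ) (M N : EdgeSet G)
           (maxM : IsMaxBMatching G b M) (maxN : IsMaxBMatching G b N)
           (S : Node (n G) → Bool) where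

  open Bipartition G c proper
  open Residual G c proper b M

  inS : Fin (n G) → Bool
  inS x = S (vtx x)

  same-size : size G N ≡ size G M
  same-size = ≤-antisym (proj₂ maxM N (proj₁ maxN)) (proj₂ maxN M (proj₁ maxM))

  saturated : ∀ (w : Fin (n G) → Bool) → (∀ x → w x ≡ true → b x ≤ degIn G M x) →
    sumFin (n G) (λ x → bit (w x) * degIn G N x) ≤ sumFin (n G) (λ x → bit (w x) * degIn G M x)
  saturated w sat = sumFin-mono (n G) term
    where
    term : ∀ x → bit (w x) * degIn G N x ≤ bit (w x) * degIn G M x
    term x with w x in wx
    ... | true  = +-monoˡ-≤ 0 (≤-trans (proj₁ maxN x) (sat x wx))
    ... | false = z≤n

  endsInA endsInB : EdgeSet G → ℕ
  endsInA X = sumFin (m G) (λ g → bit (X g) * bit (inS (aEnd g)))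
  endsInB X = sumFin (m G) (λ g → bit (X g) * bit (inS (bEnd g)))

  module _ (closed : ∀ {x y} → Arc x y → S x ≡ true → S y ≡ true) where

    -- If the source is in S, every unsaturated A-vertex is; otherwise no A-vertex is.
    endsInA-grows : endsInA M ≤ endsInA N
    endsInA-grows with S src in srcS
    ... | false = ≤-trans (≤-reflexive (sumFin-zero (m G) none)) z≤n
      where
      none : ∀ g → bit (M g) * bit (inS (aEnd g)) ≡ 0
      none g with inS (aEnd g) in aS
      ... | true  = true-false (closed (toS (aEnd-colour g)) aS) srcS
      ... | false = *-zeroʳ (bit (M g))
    ... | true = +-cancelʳ-≤ (endsOutA M) (endsInA M) (endsInA N) (begin
        endsInA M + endsOutA M  ≡⟨ split M ⟩
        size G M                ≡⟨ same-size ⟨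
        size G N                ≡⟨ split N ⟨
        endsInA N + endsOutA N  ≤⟨ +-monoʳ-≤ (endsInA N) outA-shrinks ⟩
        endsInA N + endsOutA M  ∎)
      where
      open ≤-Reasoning
      endsOutA : EdgeSet G → ℕ
      endsOutA X = sumFin (m G) (λ g → bit (X g) * bit (not (inS (aEnd g))))
      split : ∀ X → endsInA X + endsOutA X ≡ size G X
      split X = trans (sym (sumFin-+ (m G) _ _)) (sumFin-cong (m G) term)
        where
        term : ∀ g → bit (X g) * bit (inS (aEnd g)) + bit (X g) * bit (not (inS (aEnd g))) ≡ bit (X g)
        term g with inS (aEnd g)
        ... | true  = trans (cong (bit (X g) * 1 +_) (*-zeroʳ (bit (X g)))) (trans (+-identityʳ _) (*-identityʳ _))
        ... | false = trans (cong (_+ bit (X g) * 1) (*-zeroʳ (bit (X g)))) (*-identityʳ _)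
      outside-saturated : ∀ x → c x ∧ not (inS x) ≡ true → b x ≤ degIn G M x
      outside-saturated x w with c x in cx | inS x in xS
      ... | true | false = ≮⇒≥ λ lt → true-false (closed (fromS cx lt) srcS) xS
      outA-shrinks : endsOutA N ≤ endsOutA M
      outA-shrinks = begin
        endsOutA N  ≡⟨ count-A (λ x → not (inS x)) N ⟨
        _           ≤⟨ saturated (λ x → c x ∧ not (inS x)) outside-saturated ⟩
        _           ≡⟨ count-A (λ x → not (inS x)) M ⟩
        endsOutA M  ∎

    -- If the sink is in S, every B-vertex is; otherwise the B-vertices in S are saturated.
    endsInB-shrinks : endsInB N ≤ endsInB M
    endsInB-shrinks with S snk in snkS
    ... | true  = ≤-reflexive (trans (all-in N) (trans same-size (sym (all-in M))))
      where
      all-in : ∀ X → endsInB X ≡ size G X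
      all-in X = sumFin-cong (m G) λ g →
        trans (cong (λ z → bit (X g) * bit z) (closed (fromT (bEnd-colour g)) snkS)) (*-identityʳ _)
    ... | false = begin
        endsInB N  ≡⟨ count-B inS N ⟨
        _          ≤⟨ saturated (λ x → not (c x) ∧ inS x) inside-saturated ⟩
        _          ≡⟨ count-B inS M ⟩
        endsInB M  ∎
      where
      open ≤-Reasoning
      inside-saturated : ∀ x → not (c x) ∧ inS x ≡ true → b x ≤ degIn G M x
      inside-saturated x w with c x in cx | inS x in xS
      ... | false | true = ≮⇒≥ λ lt → true-false (closed (toT cx lt) xS) snkS

    no-entering : ∀ f → M f ≢ N f → inS (arcHead f) ≡ true → inS (arcTail f) ≡ true
    no-entering f M≢N headS with inS (arcTail f) in tailS
    ... | true  = refl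
    ... | false = ⊥-elim (<-irrefl refl (<-≤-trans imbalance (+-mono-≤ endsInA-grows endsInB-shrinks)))
      where
      balance : ∀ g → bit (N g) * bit (inS (aEnd g)) + bit (M g) * bit (inS (bEnd g))
                    ≤ bit (M g) * bit (inS (aEnd g)) + bit (N g) * bit (inS (bEnd g))
      balance g = edge-balance (M g) (N g) _ _ (λ Mg aS → closed (fwd g Mg) aS) (λ Mg bS → closed (bwd g Mg) bS)
      leaving : bit (N f) * bit (inS (aEnd f)) + bit (M f) * bit (inS (bEnd f))
              < bit (M f) * bit (inS (aEnd f)) + bit (N f) * bit (inS (bEnd f))
      leaving with M f
      ... | true  = edge-leaving true (N f) _ _ M≢N headS tailS
      ... | false = edge-leaving false (N f) _ _ M≢N tailS headS
      imbalance : endsInA N + endsInB M < endsInA M + endsInB N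
      imbalance = begin-strict
        endsInA N + endsInB M  ≡⟨ sumFin-+ (m G) _ _ ⟨
        sumFin (m G) (λ g → bit (N g) * bit (inS (aEnd g)) + bit (M g) * bit (inS (bEnd g)))
          <⟨ sumFin-strict (m G) balance f leaving ⟩
        sumFin (m G) (λ g → bit (M g) * bit (inS (aEnd g)) + bit (N g) * bit (inS (bEnd g)))
          ≡⟨ sumFin-+ (m G) _ _ ⟩
        endsInA M + endsInB N  ∎
        where open ≤-Reasoning

¬¬-decide-Fin : ∀ k (P : Fin k → Set) → ¬ ¬ (∀ i → Dec (P i))
¬¬-decide-Fin zero    P = pure (λ ())
¬¬-decide-Fin (suc k) P = do
  decide-zero ← ¬¬-excluded-middle
  decide-suc  ← ¬¬-decide-Fin k (λ i → P (suc i))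
  pure λ { zero → decide-zero ; (suc i) → decide-suc i }

¬¬-decide-Node : ∀ {k} (P : Node k → Set) → ¬ ¬ (∀ x → Dec (P x))
¬¬-decide-Node P = do
  decide-vtx ← ¬¬-decide-Fin _ (λ i → P (vtx i))
  decide-src ← ¬¬-excluded-middle
  decide-snk ← ¬¬-excluded-middle
  pure λ { (vtx i) → decide-vtx i ; src → decide-src ; snk → decide-snk }

witness : ∀ {A : Set} (a? : Dec A) → does a? ≡ true → A
witness (yes a) _ = a

module Flexibility (G : Graph) (c : Fin (n G) → Bool)
                   (proper : ∀ g → c (proj₁ (ends G g)) ≢ c (proj₂ (ends G g)))
                   (b : Fin (n G) → ℕ) (M : EdgeSet G) (maxM : IsMaxBMatching G b M) where

  open Bipartition G c proper
  open Residual G c proper b M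

  -- If another maximum b-matching disagrees with M on `f`, the arc of `f` lies on a
  -- cycle of D(M): otherwise the set reachable from its head would violate the cut lemma.
  disagreement-cycle : ∀ N → IsMaxBMatching G b N → ∀ f → M f ≢ N f →
    ¬ ¬ Path (vtx (arcHead f)) (vtx (arcTail f))
  disagreement-cycle N maxN f M≢N noCycle =
    ¬¬-decide-Node (Path (vtx (arcHead f))) λ reach? →
      let open Cut G c proper b M N maxM maxN (λ x → does (reach? x))
          closed : ∀ {x y} → Arc x y → does (reach? x) ≡ true → does (reach? y) ≡ true
          closed {x} {y} a reaches-x = dec-true (reach? y) (witness (reach? x) reaches-x ◅◅ (a ◅ ε))
      in true-false (no-entering closed f M≢N (dec-true (reach? _) ε)) (dec-false (reach? _) noCycle)

  flexible-disagreement : ∀ f → BFlexible G b f → ¬ ¬ Σ (EdgeSet G) λ N → IsMaxBMatching G b N × M f ≢ N f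
  flexible-disagreement f ((N₁ , maxN₁ , N₁f) , notInevitable) noDisagreement with M f
  ... | false = noDisagreement (N₁ , maxN₁ , λ eq → true-false N₁f (sym eq))
  ... | true  = notInevitable ((N₁ , maxN₁ , N₁f) , λ N maxN →
                  decidable-stable (N f ≟ᴮ true) λ Nf≢true → noDisagreement (N , maxN , λ eq → Nf≢true (sym eq)))

  arc-ends : ∀ f → (arcTail f ≡ end₁ f × arcHead f ≡ end₂ f) ⊎ (arcTail f ≡ end₂ f × arcHead f ≡ end₁ f)
  arc-ends f with M f | ends-oriented f
  ... | true  | inj₁ (e₁ , e₂) = inj₂ (sym e₂ , sym e₁)
  ... | true  | inj₂ (e₁ , e₂) = inj₁ (sym e₁ , sym e₂)
  ... | false | inj₁ (e₁ , e₂) = inj₁ (sym e₁ , sym e₂)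
  ... | false | inj₂ (e₁ , e₂) = inj₂ (sym e₂ , sym e₁)

  ⇄-from-arc : ∀ f → vtx (arcTail f) ⇄ vtx (arcHead f) → vtx (end₁ f) ⇄ vtx (end₂ f)
  ⇄-from-arc f t⇄h with arc-ends f
  ... | inj₁ (t≡ , h≡) = subst₂ (λ u v → vtx u ⇄ vtx v) t≡ h≡ t⇄h
  ... | inj₂ (t≡ , h≡) = ⇄-sym (subst₂ (λ u v → vtx u ⇄ vtx v) t≡ h≡ t⇄h)

  ⇄-to-arc : ∀ f → vtx (end₁ f) ⇄ vtx (end₂ f) → vtx (arcTail f) ⇄ vtx (arcHead f)
  ⇄-to-arc f ends⇄ with arc-ends f
  ... | inj₁ (t≡ , h≡) = subst₂ (λ u v → vtx u ⇄ vtx v) (sym t≡) (sym h≡) ends⇄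
  ... | inj₂ (t≡ , h≡) = subst₂ (λ u v → vtx u ⇄ vtx v) (sym t≡) (sym h≡) (⇄-sym ends⇄)

  flexible-strong : ∀ f → BFlexible G b f → ¬ ¬ (vtx (end₁ f) ⇄ vtx (end₂ f))
  flexible-strong f flexible = do
    (N , maxN , M≢N) ← flexible-disagreement f flexible
    back ← disagreement-cycle N maxN f M≢N
    pure (⇄-from-arc f (edgeArc f ◅ ε , back))

  component-strong : ∀ {x y} → SameFlexComponent G b x y → ¬ ¬ (vtx x ⇄ vtx y)
  component-strong ε = pure (ε , ε)
  component-strong ((f , flexible , orientation) ◅ rest) = do
    ends⇄ ← flexible-strong f flexible
    rest⇄ ← component-strong rest
    pure (⇄-trans (oriented ends⇄ orientation) rest⇄)
    where
    oriented : ∀ {x y} → vtx (end₁ f) ⇄ vtx (end₂ f) →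
      (end₁ f ≡ x × end₂ f ≡ y) ⊎ (end₁ f ≡ y × end₂ f ≡ x) → vtx x ⇄ vtx y
    oriented ends⇄ (inj₁ (refl , refl)) = ends⇄
    oriented ends⇄ (inj₂ (refl , refl)) = ⇄-sym ends⇄

module _ (G : Graph) (b : Fin (n G) → ℕ) where

  disagreement-flexible : ∀ {M N} e → IsMaxBMatching G b M → IsMaxBMatching G b N → N e ≡ not (M e) →
    BFlexible G b e
  disagreement-flexible {M} {N} e maxM maxN Ne with M e in Me
  ... | true  = (M , maxM , Me) , λ (_ , always) → true-false (always N maxN) Ne
  ... | false = (N , maxN , Ne) , λ (_ , always) → true-false (always M maxM) Me

  component-matching : ∀ {x y} → x ≢ y → SameFlexComponent G b x y → Σ (EdgeSet G) (IsMaxBMatching G b)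
  component-matching x≢y ε                                       = ⊥-elim (x≢y refl)
  component-matching _   ((_ , ((M , maxM , _) , _) , _) ◅ _) = M , maxM

  any-edge-set? : (P : EdgeSet G → Set) → (∀ X Y → (∀ g → X g ≡ Y g) → P X → P Y) → (∀ X → Dec (P X)) →
    Dec (Σ (EdgeSet G) P)
  any-edge-set? P respects P? with anySubset? (λ S → P? (lookup S))
  ... | yes (S , PS) = yes (lookup S , PS)
  ... | no none      = no λ (X , PX) → none (tabulate X , respects X _ (λ g → sym (lookup∘tabulate X g)) PX)

  isBMatching? : ∀ X → Dec (IsBMatching G b X)
  isBMatching? X = all? (λ x → degIn G X x ≤? b x)

  bMatching-respects : ∀ X Y → (∀ g → X g ≡ Y g) → IsBMatching G b X → IsBMatching G b Y
  bMatching-respects X Y X≗Y bounded x = ≤-trans (≤-reflexive (degIn-local G Y X x (λ g _ → sym (X≗Y g)))) (bounded x)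

  isMaxBMatching? : ∀ X → Dec (IsMaxBMatching G b X)
  isMaxBMatching? X with isBMatching? X
  ... | no unbounded = no (λ maxX → unbounded (proj₁ maxX))
  ... | yes bounded with any-edge-set? (λ Y → IsBMatching G b Y × size G X < size G Y) respects larger?
    where
    respects : ∀ Y Z → (∀ g → Y g ≡ Z g) →
      IsBMatching G b Y × size G X < size G Y → IsBMatching G b Z × size G X < size G Z
    respects Y Z Y≗Z (boundedY , lt) = bMatching-respects Y Z Y≗Z boundedY , <-≤-trans lt (≤-reflexive (size-cong G Y Z Y≗Z))
    larger? : ∀ Y → Dec (IsBMatching G b Y × size G X < size G Y)
    larger? Y = isBMatching? Y ×-dec (size G X <? size G Y)
  ...   | yes (Y , boundedY , lt) = no λ maxX → <⇒≱ lt (proj₂ maxX Y boundedY)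
  ...   | no noLarger            = yes (bounded , λ Y boundedY → ≮⇒≥ λ lt → noLarger (Y , boundedY , lt))

  bAllowed? : ∀ e → Dec (BAllowed G b e)
  bAllowed? e = any-edge-set? (λ X → IsMaxBMatching G b X × X e ≡ true) respects
    (λ X → isMaxBMatching? X ×-dec (X e ≟ᴮ true))
    where
    respects : ∀ X Y → (∀ g → X g ≡ Y g) → IsMaxBMatching G b X × X e ≡ true → IsMaxBMatching G b Y × Y e ≡ true
    respects X Y X≗Y ((boundedX , maximumX) , Xe) =
      (bMatching-respects X Y X≗Y boundedX , λ Z boundedZ → ≤-trans (maximumX Z boundedZ) (≤-reflexive (size-cong G X Y X≗Y)))
      , trans (sym (X≗Y e)) Xe

  -- b-flexibility is stable under double negation, since b-allowedness is decidable.
  flexible-stable : ∀ e → ¬ ¬ BFlexible G b e → BFlexible G b e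
  flexible-stable e ¬¬flexible =
    decidable-stable (bAllowed? e) (λ notAllowed → ¬¬flexible (λ flexible → notAllowed (proj₁ flexible)))
    , λ inevitable → ¬¬flexible (λ flexible → proj₂ flexible inevitable)

-- Theorem.  In a bipartite graph every edge joining two vertices of one b-flexible
-- component is b-flexible.
mainTheorem7 : (G : Graph) → Simple G → Bipartite G → (b : Fin (n G) → ℕ) →
    (e : Fin (m G)) →
    SameFlexComponent G b (proj₁ (ends G e)) (proj₂ (ends G e)) →
    BFlexible G b e
mainTheorem7 G _ (c , proper) b e sameComponent = flexible-stable G b e do
  let open Bipartition G c proper using (loopless)
      (M , maxM) = component-matching G b (loopless e) sameComponent
      open Residual G c proper b M using (exchange)
      open Flexibility G c proper b M maxM using (component-strong; ⇄-to-arc)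
  ends⇄ ← component-strong sameComponent
  let (N , maxN , Ne) = exchange maxM e (proj₂ (⇄-to-arc e ends⇄))
  pure (disagreement-flexible G b e maxM maxN Ne)
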